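{- Let $n \geq 2$ and let $g \in \mathrm{Aut}(T_n)$ satisfy: (i) $g$ acts as the identity on the subtree of vertices of level $\le n-1$; (ii) for each vertex $w$ of level $n-2$, $g$ induces an even permutation of the $9$ leaves of $T_n$ lying above $w$ (i.e., the descendants of $w$ at level $n$). Then $g \in E_n$.
   Context: $T_n$ is the regular ternary rooted tree with $n$ levels: vertices at level $i$ are sequences $(\ell_1,\dots,\ell_i)$ with $\ell_j\in\{1,2,3\}$, and $(\ell_1,\dots,\ell_i)$ is joined to $(\ell_1,\dots,\ell_{i+1})$. $\mathrm{Aut}(T_n)$ is identified with $\mathrm{Aut}(T_{n-1})\wr\mathrm{Aut}(T_1)$: $((a_1,a_2,a_3),b)$ sends $(i,\ell_2,\dots,\ell_k)$ to $(b(i),a_i(\ell_2,\dots,\ell_k))$. $\mathrm{sgn}_2(\sigma)$ is the sign of the permutation induced by $\sigma$ on the 9 vertices of level $2$. Define $E_1=\mathrm{Aut}(T_1)\cong\mathfrak S_3$ and, for $n\ge2$, $E_n=\{\sigma=((a_1,a_2,a_3),b)\in\mathrm{Aut}(T_n): a_1,a_2,a_3\in E_{n-1},\ \mathrm{sgn}_2(\sigma)=1\}$. -}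

module Defs where

open import Data.Nat using (ℕ; zero; suc; _+_; _*_; _%_; _<ᵇ_)
open import Data.Bool using (Bool; _∧_)
open import Data.Unit using (⊤; tt)
open import Data.Product using (_×_; _,_)
open import Data.Fin using (Fin; toℕ)
open import Data.Fin.Permutation using (Permutation′; _⟨$⟩ʳ_)
open import Data.Vec using (Vec; []; _∷_)
open import Data.List using (List; map; concatMap; allFin; cartesianProduct; filterᵇ; length)
open import Relation.Binary.PropositionalEquality using (_≡_)

-- Aut(T_n) ≅ Aut(T_{n-1}) ≀ S_3, built recursively:
-- an element of Aut (suc n) is ((a₁ , a₂ , a₃) , b) with aᵢ ∈ Aut n, b ∈ S_3.
Aut : ℕ → Set
Aut zero    = ⊤
Aut (suc n) = (Aut n × Aut n × Aut n) × Permutation′ 3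

child : ∀ {n} → Aut n × Aut n × Aut n → Fin 3 → Aut n
child (a₁ , a₂ , a₃) Fin.zero             = a₁
child (a₁ , a₂ , a₃) (Fin.suc Fin.zero)   = a₂
child (a₁ , a₂ , a₃) (Fin.suc (Fin.suc Fin.zero)) = a₃

-- Action of g ∈ Aut(T_n) on vertices of level k (sequences of length k).
-- ((a₁,a₂,a₃),b) sends (i , ℓ₂ … ℓ_k) to (b(i) , a_i(ℓ₂ … ℓ_k)).
-- (Only meaningful for k ≤ n; for k > n the letters beyond level n are left fixed.)
act : ∀ {n k} → Aut n → Vec (Fin 3) k → Vec (Fin 3) k
act {zero}  g v = v
act {suc n} g [] = []
act {suc n} (as , b) (i ∷ v) = (b ⟨$⟩ʳ i) ∷ act (child as i) v

-- The 9 sequences of length 2 (i.e. vertices of level 2, or the 9 leaves above a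
-- vertex two levels below), with an injective numbering into {0..8}.
pairs : List (Vec (Fin 3) 2)
pairs = concatMap (λ x → map (λ y → x ∷ y ∷ []) (allFin 3)) (allFin 3)

code : Vec (Fin 3) 2 → ℕ
code (x ∷ y ∷ []) = 3 * toℕ x + toℕ y

inversions : (Vec (Fin 3) 2 → Vec (Fin 3) 2) → ℕ
inversions σ = length (filterᵇ inv (cartesianProduct pairs pairs))
  where
  inv : Vec (Fin 3) 2 × Vec (Fin 3) 2 → Bool
  inv (u , v) = (code u <ᵇ code v) ∧ (code (σ v) <ᵇ code (σ u))

IsEven : (Vec (Fin 3) 2 → Vec (Fin 3) 2) → Set
IsEven σ = inversions σ % 2 ≡ 0

Sgn₂One : ∀ {n} → Aut n → Set
Sgn₂One g = IsEven (act g)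

-- membership in E_n (n ≥ 1); E_1 = Aut(T_1); the n = 0 clause is unused.
InE : (n : ℕ) → Aut n → Set
InE zero          g = ⊤
InE (suc zero)    g = ⊤
InE (suc (suc n)) g@((a₁ , a₂ , a₃) , b) =
  InE (suc n) a₁ × InE (suc n) a₂ × InE (suc n) a₃ × Sgn₂One {suc (suc n)} g

module Submission where

-- Write g = ((a₁ , a₂ , a₃) , b) ∈ Aut(T_{m+2}).  Membership in
-- E_{m+2} asks for two things: each aᵢ lies in E_{m+1}, and g acts evenly on
-- the 9 vertices of level 2.
--   * If g fixes all levels ≤ m+1 and m ≥ 1, then g fixes level 2 pointwise,
--     so its level-2 permutation is the identity, which is even.

open import Defs
open import Data.Nat using (ℕ; suc; zero; _≤_; s≤s; z≤n; _%_; _<ᵇ_)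
open import Data.Fin using (Fin)
import Data.Fin as Fin
open import Data.Fin.Permutation using (Permutation′)
open import Data.Vec using (Vec; _++_; drop; _∷_; tail)
import Data.Vec as Vec
open import Data.Product using (_,_; _×_)
open import Data.List using (List; []; _∷_; length; filterᵇ; cartesianProduct)
open import Data.Bool using (Bool; true; false; _∧_)
open import Function using (id)
open import Relation.Binary.PropositionalEquality using (_≡_; refl; cong; _≗_)

FixesLevelsUpTo : ∀ {n} → ℕ → Aut n → Set
FixesLevelsUpTo d g = ∀ (k : ℕ) → k ≤ d → (v : Vec (Fin 3) k) → act g v ≡ v

-- Above every vertex w of level m, g permutes the 9 vertices two levels
-- higher evenly (read as the last two letters of g(w ++ u)).
EvenAbove : ∀ {n} → ℕ → Aut n → Set
EvenAbove m g = ∀ (w : Vec (Fin 3) m) → IsEven (λ u → drop m (act g (w ++ u)))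

length-filterᵇ-cong : ∀ {A : Set} {p q : A → Bool} → p ≗ q
  → (xs : List A) → length (filterᵇ p xs) ≡ length (filterᵇ q xs)
length-filterᵇ-cong p≗q []       = refl
length-filterᵇ-cong {p = p} {q} p≗q (x ∷ xs) with p x | q x | p≗q x
... | true  | .true  | refl = cong suc (length-filterᵇ-cong p≗q xs)
... | false | .false | refl = length-filterᵇ-cong p≗q xs

IsInversion : (Vec (Fin 3) 2 → Vec (Fin 3) 2) → Vec (Fin 3) 2 × Vec (Fin 3) 2 → Bool
IsInversion σ (u , v) = (code u <ᵇ code v) ∧ (code (σ v) <ᵇ code (σ u))

inversions-cong : ∀ {σ τ : Vec (Fin 3) 2 → Vec (Fin 3) 2}
  → σ ≗ τ → inversions σ ≡ inversions τ
inversions-cong {σ} {τ} σ≗τ =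
  length-filterᵇ-cong same-test (cartesianProduct pairs pairs)
  where
  same-test : IsInversion σ ≗ IsInversion τ
  same-test (u , v) rewrite σ≗τ u | σ≗τ v = refl

fixes-level-two⇒sgn₂One : ∀ {n} (g : Aut n)
  → (∀ (v : Vec (Fin 3) 2) → act g v ≡ v) → Sgn₂One g
fixes-level-two⇒sgn₂One g fixes = cong (_% 2) (inversions-cong {act g} {id} fixes)

child-fixes : ∀ {n d} (as : Aut n × Aut n × Aut n) (b : Permutation′ 3)
  → FixesLevelsUpTo {suc n} (suc d) (as , b)
  → ∀ i → FixesLevelsUpTo d (child as i)
child-fixes as b fixes i k k≤d v = cong tail (fixes (suc k) (s≤s k≤d) (i ∷ v))

child-evenAbove : ∀ {n m} (as : Aut n × Aut n × Aut n) (b : Permutation′ 3)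
  → EvenAbove {suc n} (suc m) (as , b)
  → ∀ i → EvenAbove m (child as i)
child-evenAbove as b even i w = even (i ∷ w)

fixed-and-even⇒InE : ∀ m (g : Aut (suc (suc m)))
  → FixesLevelsUpTo (suc m) g → EvenAbove m g → InE (suc (suc m)) g
fixed-and-even⇒InE zero    g fixes even = _ , _ , _ , even Vec.[]
fixed-and-even⇒InE (suc m) g@(as@(a₁ , a₂ , a₃) , b) fixes even =
  child-in-E Fin.zero , child-in-E (Fin.suc Fin.zero) ,
  child-in-E (Fin.suc (Fin.suc Fin.zero)) ,
  fixes-level-two⇒sgn₂One g (fixes 2 (s≤s (s≤s z≤n)))
  where
  child-in-E : ∀ i → InE (suc (suc m)) (child as i)
  child-in-E i = fixed-and-even⇒InE m (child as i)
    (child-fixes as b fixes i) (child-evenAbove as b even i)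

lemma2p8 : (m : ℕ) (g : Aut (suc (suc m)))
    → (∀ (k : ℕ) → k ≤ suc m → (v : Vec (Fin 3) k) → act g v ≡ v)
    → (∀ (w : Vec (Fin 3) m) → IsEven (λ u → drop m (act g (w ++ u))))
    → InE (suc (suc m)) g
lemma2p8 = fixed-and-even⇒InE
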